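{- Let $\Gamma$ be a simple connected graph having a vertex of degree $1$. Then there exists a non-zero $(0,1)$-vector in the row space of the adjacency matrix $A(\Gamma)$ over $\mathbb{R}$ which does not occur as a row of $A(\Gamma)$.
   Context: The adjacency matrix $A(\Gamma)=(a_{ij})$ has $a_{ij}=1$ if $v_i$ is adjacent to $v_j$ and $0$ otherwise; the row space is over the real numbers. -}

module Defs where

open import Data.Nat using (ℕ; zero; suc)
open import Data.Bool using (Bool; true; false; if_then_else_)
open import Data.Fin using (Fin; zero; suc)
open import Data.Rational using (ℚ; 0ℚ; 1ℚ; _+_; _*_)
open import Relation.Binary.PropositionalEquality using (_≡_)

record SimpleGraph (n : ℕ) : Set where
  field
    adj     : Fin n → Fin n → Bool
    symm    : ∀ i j → adj i j ≡ adj j i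
    irrefl  : ∀ i → adj i i ≡ false
open SimpleGraph public

sumℕ : ∀ {n} → (Fin n → ℕ) → ℕ
sumℕ {zero}  f = 0
sumℕ {suc n} f = f zero Data.Nat.+ sumℕ (λ i → f (suc i))

sumℚ : ∀ {n} → (Fin n → ℚ) → ℚ
sumℚ {zero}  f = 0ℚ
sumℚ {suc n} f = f zero + sumℚ (λ i → f (suc i))

b2ℕ : Bool → ℕ
b2ℕ b = if b then 1 else 0

b2ℚ : Bool → ℚ
b2ℚ b = if b then 1ℚ else 0ℚ

degree : ∀ {n} → SimpleGraph n → Fin n → ℕ
degree G v = sumℕ (λ j → b2ℕ (adj G v j))

data Reachable {n} (G : SimpleGraph n) (u : Fin n) : Fin n → Set where
  here : Reachable G u u
  step : ∀ {v w} → Reachable G u v → adj G v w ≡ true → Reachable G u w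

Connected : ∀ {n} → SimpleGraph n → Set
Connected G = ∀ u v → Reachable G u v

-- Adjacency matrix A(Γ) with real (here rational) 0/1 entries.
adjMatrix : ∀ {n} → SimpleGraph n → Fin n → Fin n → ℚ
adjMatrix G i j = b2ℚ (adj G i j)

InRowSpace : ∀ {n} → SimpleGraph n → (Fin n → ℚ) → Set
InRowSpace {n} G x =
  Data.Product.Σ (Fin n → ℚ) (λ c → ∀ j → sumℚ (λ i → c i * adjMatrix G i j) ≡ x j)
  where import Data.Product

{-# OPTIONS --safe #-}
-- If v is a leaf with unique neighbour u, the row of v is the unit vector e_u, so
-- x = row u + row v = row u + e_u lies in the row space; it is a 0/1-vector since
-- u is not its own neighbour. A row of A(Γ) equal to x would have a 1 in column v,
-- hence be the row of u, whose entry in column u is 0, not 1.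
module Submission where

open import Defs
open import Data.Nat using (ℕ; zero; suc)
open import Data.Nat.Properties using (suc-injective)
open import Data.Bool using (Bool; true; false; _∨_)
open import Data.Bool.Properties using (∨-zeroʳ)
open import Data.Fin using (Fin; zero; suc)
open import Data.Fin.Properties using (_≟_)
open import Data.Empty using (⊥-elim)
open import Data.Product using (Σ; ∃; _×_; _,_)
open import Data.Rational using (ℚ; 0ℚ; _+_; _*_)
open import Data.Rational.Properties
  using (+-identityˡ; +-identityʳ; *-identityˡ; *-zeroˡ; *-distribʳ-+; +-0-commutativeMonoid)
open import Algebra.Bundles using (CommutativeMonoid)
open import Algebra.Properties.CommutativeSemigroup
  (CommutativeMonoid.commutativeSemigroup +-0-commutativeMonoid) using (interchange)
open import Relation.Nullary using (¬_; does; yes; no)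
open import Relation.Nullary.Decidable using (dec-true; dec-false)
open import Relation.Binary.PropositionalEquality
  using (_≡_; _≢_; refl; sym; trans; cong; cong₂; module ≡-Reasoning)

sumℕ-b2ℕ≡0⇒all-false : ∀ {n} (f : Fin n → Bool) →
  sumℕ (λ j → b2ℕ (f j)) ≡ 0 → ∀ j → f j ≡ false
sumℕ-b2ℕ≡0⇒all-false {suc n} f s≡0 j with f zero in f0≡
sumℕ-b2ℕ≡0⇒all-false {suc n} f s≡0 zero    | false = f0≡
sumℕ-b2ℕ≡0⇒all-false {suc n} f s≡0 (suc j) | false = sumℕ-b2ℕ≡0⇒all-false (λ i → f (suc i)) s≡0 j

sumℕ-b2ℕ≡1⇒unique-true : ∀ {n} (f : Fin n → Bool) → sumℕ (λ j → b2ℕ (f j)) ≡ 1 →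
  ∃ λ u → f u ≡ true × (∀ j → f j ≡ true → j ≡ u)
sumℕ-b2ℕ≡1⇒unique-true {zero} f ()
sumℕ-b2ℕ≡1⇒unique-true {suc n} f s≡1 with f zero in f0≡
... | true = zero , f0≡ , unique
  where
  unique : ∀ j → f j ≡ true → j ≡ zero
  unique zero    _   = refl
  unique (suc j) fj≡ with () ← trans (sym fj≡) (sumℕ-b2ℕ≡0⇒all-false _ (suc-injective s≡1) j)
... | false with u , fu≡ , unique ← sumℕ-b2ℕ≡1⇒unique-true (λ i → f (suc i)) s≡1 =
  suc u , fu≡ , unique′
  where
  unique′ : ∀ j → f j ≡ true → j ≡ suc u
  unique′ zero    fj≡ with () ← trans (sym fj≡) f0≡
  unique′ (suc j) fj≡ = cong suc (unique j fj≡)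

sumℚ-cong : ∀ {n} {f g : Fin n → ℚ} → (∀ i → f i ≡ g i) → sumℚ f ≡ sumℚ g
sumℚ-cong {zero}  f≗g = refl
sumℚ-cong {suc n} f≗g = cong₂ _+_ (f≗g zero) (sumℚ-cong (λ i → f≗g (suc i)))

sumℚ-+ : ∀ {n} (f g : Fin n → ℚ) → sumℚ (λ i → f i + g i) ≡ sumℚ f + sumℚ g
sumℚ-+ {zero}  f g = refl
sumℚ-+ {suc n} f g = trans (cong (f zero + g zero +_) (sumℚ-+ (λ i → f (suc i)) (λ i → g (suc i))))
                           (interchange (f zero) (g zero) _ _)

sumℚ-0 : ∀ {n} (f : Fin n → ℚ) → (∀ i → f i ≡ 0ℚ) → sumℚ f ≡ 0ℚ
sumℚ-0 {zero}  f f≗0 = refl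
sumℚ-0 {suc n} f f≗0 = cong₂ _+_ (f≗0 zero) (sumℚ-0 (λ i → f (suc i)) (λ i → f≗0 (suc i)))

indicator : ∀ {n} → Fin n → Fin n → ℚ
indicator u j = b2ℚ (does (u ≟ j))

sumℚ-indicator-* : ∀ {n} (u : Fin n) (f : Fin n → ℚ) → sumℚ (λ i → indicator u i * f i) ≡ f u
sumℚ-indicator-* zero f =
  trans (cong₂ _+_ (*-identityˡ (f zero)) (sumℚ-0 _ (λ i → *-zeroˡ (f (suc i)))))
        (+-identityʳ (f zero))
sumℚ-indicator-* (suc u) f =
  trans (cong₂ _+_ (*-zeroˡ (f zero)) (sumℚ-indicator-* u (λ i → f (suc i))))
        (+-identityˡ (f (suc u)))

InRowSpace-resp : ∀ {n} (G : SimpleGraph n) {x y : Fin n → ℚ} →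
  (∀ j → x j ≡ y j) → InRowSpace G x → InRowSpace G y
InRowSpace-resp G x≗y (c , c·A≡x) = c , λ j → trans (c·A≡x j) (x≗y j)

row-+-row∈RowSpace : ∀ {n} (G : SimpleGraph n) (u v : Fin n) →
  InRowSpace G (λ j → adjMatrix G u j + adjMatrix G v j)
row-+-row∈RowSpace G u v = (λ i → indicator u i + indicator v i) , c·A≡
  where
  open ≡-Reasoning
  c·A≡ : ∀ j → sumℚ (λ i → (indicator u i + indicator v i) * adjMatrix G i j)
             ≡ adjMatrix G u j + adjMatrix G v j
  c·A≡ j = begin
    sumℚ (λ i → (indicator u i + indicator v i) * adjMatrix G i j)
      ≡⟨ sumℚ-cong (λ i → *-distribʳ-+ (adjMatrix G i j) (indicator u i) (indicator v i)) ⟩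
    sumℚ (λ i → indicator u i * adjMatrix G i j + indicator v i * adjMatrix G i j)
      ≡⟨ sumℚ-+ (λ i → indicator u i * adjMatrix G i j) (λ i → indicator v i * adjMatrix G i j) ⟩
    sumℚ (λ i → indicator u i * adjMatrix G i j) + sumℚ (λ i → indicator v i * adjMatrix G i j)
      ≡⟨ cong₂ _+_ (sumℚ-indicator-* u _) (sumℚ-indicator-* v _) ⟩
    adjMatrix G u j + adjMatrix G v j ∎

leaf-row≡unit : ∀ {n} (G : SimpleGraph n) {u v : Fin n} → adj G v u ≡ true →
  (∀ j → adj G v j ≡ true → j ≡ u) → ∀ j → adj G v j ≡ does (u ≟ j)
leaf-row≡unit G {u} {v} vu unique j with adj G v j in vj
... | true  = sym (dec-true (u ≟ j) (sym (unique j vj)))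
... | false = sym (dec-false (u ≟ j) u≢j)
  where
  u≢j : u ≢ j
  u≢j refl with () ← trans (sym vj) vu

no-self-loop : ∀ {n} (G : SimpleGraph n) (u : Fin n) → adj G u u ≢ true
no-self-loop G u uu with () ← trans (sym uu) (irrefl G u)

neighbour-≢ : ∀ {n} (G : SimpleGraph n) (u j : Fin n) → ¬ (adj G u j ≡ true × does (u ≟ j) ≡ true)
neighbour-≢ G u j (uj , u≟j) with u ≟ j
... | yes refl = no-self-loop G u uj
... | no _ with () ← u≟j

b2ℚ-+-disjoint : ∀ a b → ¬ (a ≡ true × b ≡ true) → b2ℚ a + b2ℚ b ≡ b2ℚ (a ∨ b)
b2ℚ-+-disjoint true  true  ¬both = ⊥-elim (¬both (refl , refl))
b2ℚ-+-disjoint true  false _ = refl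
b2ℚ-+-disjoint false true  _ = refl
b2ℚ-+-disjoint false false _ = refl

corollary4p5 : ∀ (n : ℕ) (G : SimpleGraph n) → Connected G → (∃ λ v → degree G v ≡ 1) →
    Σ (Fin n → Bool) (λ x → (∃ λ j → x j ≡ true)
    × InRowSpace G (λ j → b2ℚ (x j))
    × (∀ i → ¬ (∀ j → adj G i j ≡ x j)))
corollary4p5 n G _ (v , deg≡1) with u , vu , unique ← sumℕ-b2ℕ≡1⇒unique-true (adj G v) deg≡1 =
  x , (u , xu) , InRowSpace-resp G row-sum≡x (row-+-row∈RowSpace G u v) , not-a-row
  where
  x : Fin n → Bool
  x j = adj G u j ∨ does (u ≟ j)

  xu : x u ≡ true
  xu = trans (cong (adj G u u ∨_) (dec-true (u ≟ u) refl)) (∨-zeroʳ (adj G u u))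

  row-sum≡x : ∀ j → adjMatrix G u j + adjMatrix G v j ≡ b2ℚ (x j)
  row-sum≡x j = trans (cong (λ b → adjMatrix G u j + b2ℚ b) (leaf-row≡unit G vu unique j))
                      (b2ℚ-+-disjoint (adj G u j) (does (u ≟ j)) (neighbour-≢ G u j))

  xv : x v ≡ true
  xv = cong (_∨ does (u ≟ v)) (trans (symm G u v) vu)

  not-a-row : ∀ i → ¬ (∀ j → adj G i j ≡ x j)
  not-a-row i rowi≡x with refl ← unique i (trans (symm G v i) (trans (rowi≡x v) xv)) =
    no-self-loop G u (trans (rowi≡x u) xu)
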